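{- Let $G=(V,E)$ be a graph whose edge set can be partitioned into the edge set of a spanning bipartite subgraph $H'$ of $G$ without trivial connected components and a set $M'$ of edges forming a matching. Then $G$ admits a partial edge colouring with $16$ colours that satisfies all edges of $G$.
   Context: All graphs are simple and finite. A connected graph is nontrivial if it has at least two edges and trivial otherwise; "without trivial connected components" means every connected component (including isolated vertices) has at least two edges. A partial edge colouring assigns colours to some (not necessarily all) edges. For an edge $e=uv$, $E[e]$ is the set of all edges incident with $u$ or $v$ and $E(e)=E[e]\setminus\{e\}$. A colour $\alpha$ is unique for $e$ if some $e'\in E(e)$ is coloured $\alpha$ and no other edge of $E[e]\setminus\{e'\}$ is coloured $\alpha$; $e$ is satisfied if such a colour exists. -}

module Defs where

open import Data.Nat using (ℕ)
open import Data.Fin using (Fin; _<_)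
open import Data.Bool using (Bool; true; false; T; not)
open import Data.Maybe using (Maybe; just)
open import Data.Product using (Σ; ∃; ∃-syntax; _×_; _,_; proj₁; proj₂)
open import Data.Sum using (_⊎_)
open import Relation.Binary.PropositionalEquality using (_≡_)
open import Relation.Nullary using (¬_)

record Graph : Set where
  field
    n     : ℕ
    adj   : Fin n → Fin n → Bool
    sym   : ∀ u v → adj u v ≡ adj v u
    irref : ∀ u → adj u u ≡ false
open Graph public

-- An edge is an unordered pair {u,v}, represented canonically by u < v.
Edge : Graph → Set
Edge G = Σ (Fin (n G) × Fin (n G)) λ p → (proj₁ p < proj₂ p) × T (adj G (proj₁ p) (proj₂ p))

ends : ∀ {G : Graph} → Edge G → Fin (n G) × Fin (n G)
ends e = proj₁ e

Incident : ∀ {G} → Fin (n G) → Edge G → Set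
Incident {G} x e = x ≡ proj₁ (ends {G} e) ⊎ x ≡ proj₂ (ends {G} e)

-- f ∈ E[e] : f shares an endpoint with e (includes f = e)
InClosedNbh : ∀ {G} → Edge G → Edge G → Set
InClosedNbh {G} e f = ∃[ x ] (Incident {G} x e × Incident {G} x f)

SameEdge : ∀ {G} → Edge G → Edge G → Set
SameEdge {G} e f = ends {G} e ≡ ends {G} f

PartialColouring : Graph → ℕ → Set
PartialColouring G k = Edge G → Maybe (Fin k)

-- α is unique for e: some e' ∈ E(e) = E[e] \ {e} is coloured α and no
-- other edge of E[e] \ {e'} is coloured α.
UniqueFor : ∀ {G k} → PartialColouring G k → Edge G → Fin k → Set
UniqueFor {G} c e α =
  ∃[ e' ] (InClosedNbh {G} e e' × ¬ SameEdge {G} e' e × c e' ≡ just α ×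
           (∀ f → InClosedNbh {G} e f → ¬ SameEdge {G} f e' → ¬ (c f ≡ just α)))

Satisfied : ∀ {G k} → PartialColouring G k → Edge G → Set
Satisfied {G} {k} c e = ∃[ α ] UniqueFor {G} {k} c e α

-- Subgraph given by an edge predicate (spanning: all vertices kept).
-- Reachability in the spanning subgraph with edge set {e | H e ≡ true}.
data Reach (G : Graph) (H : Edge G → Bool) : Fin (n G) → Fin (n G) → Set where
  here : ∀ {x} → Reach G H x x
  step : ∀ {x y z} (e : Edge G) → H e ≡ true →
         Incident {G} x e → Incident {G} y e → ¬ x ≡ y →
         Reach G H y z → Reach G H x z

Bipartite : (G : Graph) → (Edge G → Bool) → Set
Bipartite G H = Σ (Fin (n G) → Bool) λ side → (∀ (e : Edge G) → H e ≡ true →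
  ¬ (side (proj₁ (ends {G} e)) ≡ side (proj₂ (ends {G} e))))

-- Every connected component of the spanning subgraph H (including isolated
-- vertices) has at least two edges.
NoTrivialComponents : (G : Graph) → (Edge G → Bool) → Set
NoTrivialComponents G H = ∀ (v : Fin (n G)) →
  ∃[ e₁ ] ∃[ e₂ ] (H e₁ ≡ true × H e₂ ≡ true × ¬ SameEdge {G} e₁ e₂ ×
                    Reach G H v (proj₁ (ends {G} e₁)) × Reach G H v (proj₁ (ends {G} e₂)))

IsMatching : (G : Graph) → (Edge G → Bool) → Set
IsMatching G M = ∀ (e f : Edge G) → M e ≡ true → M f ≡ true →
  InClosedNbh {G} e f → SameEdge {G} e f

-- Root every component of H at its least-numbered vertex of degree at least two
-- and take a breadth-first spanning forest; as H is bipartite, the ends of every H-edge lie on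
-- consecutive levels.  Only forest edges are coloured: the edge from x to its parent gets the
-- depth of x modulo 3 together with the side of x in the matching, except that two chosen
-- children of each root get colours of their own, which also record the matching side of the
-- root.  An H-edge uv with v one level below u is satisfied by the parent edge of u, since every
-- other forest edge at u or v hangs one or two levels deeper; if u is a root, it is satisfied by
-- the edge to a chosen child other than v.  A matching edge uv is satisfied by the parent edge of
-- the end whose residue does not follow the other one (the matching sides rule out the parent
-- edge of the other end), or by an edge to a chosen child if one of its ends is a root.
module Submission where

open import Defs hiding (sym)

open import Data.Bool using (Bool; true; false; not; if_then_else_)
open import Data.Bool.Properties using (¬-not; T-irrelevant) renaming (_≟_ to _≟ᵇ_)
open import Data.Empty using (⊥; ⊥-elim)
open import Data.Fin as Fin using (Fin; toℕ; #_)
open import Data.Fin.Patterns using (0F; 1F; 2F)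
import Data.Fin.Properties as Fin
open import Data.Fin.Properties
  using (_≟_; _<?_; <-irrelevant; <-irrefl; <-asym; any?; all?; ¬∀⟶∃¬; pigeonhole; toℕ≤pred[n])
open import Data.Maybe using (Maybe; just; nothing)
open import Data.Nat as ℕ using (ℕ; zero; suc; _≤_; _≤′_; z≤n; s≤s; ≤′-refl; ≤′-step)
open import Data.Nat.Properties using (≤⇒≤′; n<1+n; n≮n; ≤-antisym; <-cmp; 0≢1+n; m≢1+n+m; suc-injective)
open import Data.Product using (∃₂; ∃-syntax; _×_; _,_; proj₁; proj₂)
open import Data.Sum using (_⊎_; inj₁; inj₂)
open import Function using (_∘_)
open import Level using (0ℓ)
open import Relation.Binary using (Rel; Decidable; Symmetric; tri<; tri≈; tri>)
open import Relation.Binary.PropositionalEquality using (_≡_; _≢_; refl; sym; trans; subst; cong; cong₂)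
open import Relation.Nullary
  using (¬_; Dec; does; yes; no; map′; ¬?; _×-dec_; _⊎-dec_; _→-dec_; contradiction)
open import Relation.Nullary.Decidable using (decidable-stable; T?; dec-true; dec-false)

least : ∀ {p} {P : ℕ → Set p} → (∀ k → Dec (P k)) → ∀ {m} → P m →
        ∃[ k ] (P k × ∀ {j} → P j → k ≤ j)
least P? p with P? 0
... | yes p₀ = 0 , p₀ , λ _ → z≤n
least P? {zero}  p | no ¬p₀ = contradiction p ¬p₀
least {P = P} P? {suc m} p | no ¬p₀ with least (λ k → P? (suc k)) p
... | k , pk , minimal = suc k , pk , above
  where
  above : ∀ {j} → P j → suc k ≤ j
  above {zero}  p₀ = contradiction p₀ ¬p₀
  above {suc j} pj = s≤s (minimal pj)

module Walks {n : ℕ} (_~_ : Rel (Fin n) 0ℓ) (_~?_ : Decidable _~_) (~-sym : Symmetric _~_) where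

  Near : ℕ → Fin n → Fin n → Set
  Near zero    x y = x ≡ y
  Near (suc k) x y = Near k x y ⊎ ∃[ z ] (Near k x z × z ~ y)

  near? : ∀ k x y → Dec (Near k x y)
  near? zero    x y = x ≟ y
  near? (suc k) x y = near? k x y ⊎-dec any? (λ z → near? k x z ×-dec z ~? y)

  near-≤ : ∀ {j k x y} → j ≤ k → Near j x y → Near k x y
  near-≤ j≤k = go (≤⇒≤′ j≤k)
    where
    go : ∀ {j k x y} → j ≤′ k → Near j x y → Near k x y
    go ≤′-refl       p = p
    go (≤′-step j≤k) p = inj₁ (go j≤k p)

  Stable : ℕ → Fin n → Set
  Stable k x = ∀ {y} → Near (suc k) x y → Near k x y

  stable-closed : ∀ {k x} → Stable k x → ∀ m {y} → Near m x y → Near k x y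
  stable-closed st zero    refl               = near-≤ z≤n refl
  stable-closed st (suc m) (inj₁ p)           = stable-closed st m p
  stable-closed st (suc m) (inj₂ (z , p , q)) = st (inj₂ (z , stable-closed st m p , q))

  Grows : ℕ → Fin n → Set
  Grows k x = ∃[ y ] (Near (suc k) x y × ¬ Near k x y)

  grows? : ∀ k x → Dec (Grows k x)
  grows? k x = any? λ y → near? (suc k) x y ×-dec ¬? (near? k x y)

  -- Balls growing at each of the first n + 1 steps would contain n + 1 distinct vertices.
  eventually-stable : ∀ x → ∃[ k ] (k ≤ n × Stable k x)
  eventually-stable x with all? (λ (k : Fin (suc n)) → grows? (toℕ k) x)
  ... | yes grows = ⊥-elim (ball-overflow grows)
    where
    ball-overflow : (∀ k → Grows (toℕ k) x) → ⊥
    ball-overflow grows with pigeonhole (n<1+n n) (λ k → proj₁ (grows k))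
    ... | i , j , i<j , same =
      proj₂ (proj₂ (grows j)) (subst (Near (toℕ j) x) same (near-≤ i<j (proj₁ (proj₂ (grows i)))))
  ... | no ¬grows with ¬∀⟶∃¬ _ _ (λ k → grows? (toℕ k) x) ¬grows
  ...   | k , ¬grows-k = toℕ k , toℕ≤pred[n] k ,
            λ {y} p → decidable-stable (near? (toℕ k) x y) (λ ¬q → ¬grows-k (y , p , ¬q))

  Connected : Fin n → Fin n → Set
  Connected = Near n

  connected : ∀ {k x y} → Near k x y → Connected x y
  connected {k} {x} p with eventually-stable x
  ... | j , j≤n , st = near-≤ j≤n (stable-closed st k p)

  connected-refl : ∀ {x} → Connected x x
  connected-refl = connected {0} refl

  adjacent-connected : ∀ {x y} → x ~ y → Connected x y
  adjacent-connected x~y = connected {1} (inj₂ (_ , refl , x~y))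

  connected-trans : ∀ {k x y z} → Connected x y → Near k y z → Connected x z
  connected-trans {zero}  c refl               = c
  connected-trans {suc k} c (inj₁ p)           = connected-trans c p
  connected-trans {suc k} c (inj₂ (w , p , q)) = connected {suc n} (inj₂ (w , connected-trans c p , q))

  connected-sym : ∀ {k x y} → Near k x y → Connected y x
  connected-sym {zero}  refl               = connected-refl
  connected-sym {suc k} (inj₁ p)           = connected-sym p
  connected-sym {suc k} (inj₂ (w , p , q)) = connected-trans (adjacent-connected (~-sym q)) (connected-sym p)

  connected? : ∀ x y → Dec (Connected x y)
  connected? = near? n

  Branching : Fin n → Set
  Branching x = ∃₂ λ y z → x ~ y × x ~ z × y ≢ z

  branching? : ∀ x → Dec (Branching x)
  branching? x = any? λ y → any? λ z → x ~? y ×-dec x ~? z ×-dec ¬? (y ≟ z)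

  only-neighbour : ∀ {x y z} → ¬ Branching x → x ~ y → x ~ z → z ≡ y
  only-neighbour {y = y} {z} ¬br x~y x~z with z ≟ y
  ... | yes z≡y = z≡y
  ... | no z≢y  = ⊥-elim (¬br (z , y , x~z , x~y , z≢y))

  isolated-edge : ∀ {a b} → a ~ b → ¬ Branching a → ¬ Branching b →
                  ∀ k {z} → Near k a z → z ≡ a ⊎ z ≡ b
  isolated-edge a~b ¬br-a ¬br-b zero    refl     = inj₁ refl
  isolated-edge a~b ¬br-a ¬br-b (suc k) (inj₁ p) = isolated-edge a~b ¬br-a ¬br-b k p
  isolated-edge a~b ¬br-a ¬br-b (suc k) (inj₂ (w , p , w~z)) with isolated-edge a~b ¬br-a ¬br-b k p
  ... | inj₁ refl = inj₂ (only-neighbour ¬br-a a~b w~z)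
  ... | inj₂ refl = inj₁ (only-neighbour ¬br-b (~-sym a~b) w~z)

  -- The two neighbours witnessing that x branches (x itself if it does not).
  opaque
    fork : Bool → Fin n → Fin n
    fork i x with branching? x
    fork false x | yes (y , _ , _) = y
    fork true  x | yes (_ , z , _) = z
    fork _     x | no _            = x

    fork-adjacent : ∀ {x} → Branching x → ∀ i → x ~ fork i x
    fork-adjacent {x} br i with branching? x
    fork-adjacent br false | yes (_ , _ , x~y , _)       = x~y
    fork-adjacent br true  | yes (_ , _ , _ , x~z , _)   = x~z
    fork-adjacent br _     | no ¬br                      = ⊥-elim (¬br br)

    fork-distinct : ∀ {x} → Branching x → fork false x ≢ fork true x
    fork-distinct {x} br with branching? x
    ... | yes (_ , _ , _ , _ , y≢z) = y≢z
    ... | no ¬br                    = ⊥-elim (¬br br)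

  module Forest (branching-nearby : ∀ x → ∃[ r ] (Branching r × Connected r x))
                (side : Fin n → Bool) (side-proper : ∀ {x y} → x ~ y → side x ≢ side y) where

    -- Each component is rooted at its least branching vertex, a choice made the same way
    -- from every vertex of the component.
    IsRoot : Fin n → Set
    IsRoot r = Branching r × (∀ r′ → Branching r′ → Connected r′ r → r Fin.≤ r′)

    isRoot? : ∀ r → Dec (IsRoot r)
    isRoot? r = branching? r ×-dec all? λ r′ → branching? r′ →-dec (connected? r′ r →-dec r Fin.≤? r′)

    roots-unique : ∀ {r r′} → IsRoot r → IsRoot r′ → Connected r r′ → r ≡ r′
    roots-unique (br , least-r) (br′ , least-r′) c =
      Fin.≤-antisym (least-r _ br′ (connected-sym c)) (least-r′ _ br c)

    root-exists : ∀ x → ∃[ r ] (IsRoot r × Connected r x)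
    root-exists x with branching-nearby x
    ... | r₀ , br₀ , c₀
      with least (λ k → any? λ r → (toℕ r ℕ.≟ k) ×-dec (branching? r ×-dec connected? r x)) (r₀ , refl , br₀ , c₀)
    ...   | _ , (r , refl , br , c) , minimal =
            r , (br , λ r′ br′ c′ → minimal (r′ , refl , br′ , connected-trans c′ c)) , c

    Reached : ℕ → Fin n → Set
    Reached k x = ∃[ r ] (IsRoot r × Near k r x)

    private
      shallowest : ∀ x → ∃[ k ] (Reached k x × ∀ {j} → Reached j x → k ≤ j)
      shallowest x = least (λ k → any? λ r → isRoot? r ×-dec near? k r x) (root-exists x)

    opaque
      depth : Fin n → ℕ
      depth x = proj₁ (shallowest x)

      depth-reached : ∀ x → Reached (depth x) x
      depth-reached x = proj₁ (proj₂ (shallowest x))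

      depth-minimal : ∀ {j x} → Reached j x → depth x ≤ j
      depth-minimal {x = x} = proj₂ (proj₂ (shallowest x))

    depth-zero : ∀ {x} → depth x ≡ 0 → IsRoot x
    depth-zero {x} d≡0 with subst (λ k → Reached k x) d≡0 (depth-reached x)
    ... | r , root , refl = root

    depth-adjacent : ∀ {x y} → x ~ y → depth y ≤ suc (depth x)
    depth-adjacent {x} x~y with depth-reached x
    ... | r , root , p = depth-minimal (r , root , inj₂ (x , p , x~y))

    NonRoot : Fin n → Set
    NonRoot x = depth x ≢ 0

    parent-exists : ∀ {x} → NonRoot x → ∃[ p ] (p ~ x × depth x ≡ suc (depth p))
    parent-exists {x} nr with depth x in eq | depth-reached x
    ... | zero  | _ = ⊥-elim (nr refl)
    ... | suc k | r , root , inj₁ r→x = ⊥-elim (n≮n k (subst (_≤ k) eq (depth-minimal (r , root , r→x))))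
    ... | suc k | r , root , inj₂ (p , r→p , p~x) =
          p , p~x , cong suc (≤-antisym k≤depth-p (depth-minimal (r , root , r→p)))
      where
      k≤depth-p : k ≤ depth p
      k≤depth-p with subst (_≤ suc (depth p)) eq (depth-adjacent p~x)
      ... | s≤s k≤ = k≤

    -- Meaningful for non-roots only; a root is its own parent.
    opaque
      parent : Fin n → Fin n
      parent x with any? (λ p → p ~? x ×-dec depth x ℕ.≟ suc (depth p))
      ... | yes (p , _) = p
      ... | no _        = x

      parent-spec : ∀ {x} → NonRoot x → parent x ~ x × depth x ≡ suc (depth (parent x))
      parent-spec {x} nr with any? (λ p → p ~? x ×-dec depth x ℕ.≟ suc (depth p))
      ... | yes (_ , spec) = spec
      ... | no none        = ⊥-elim (none (parent-exists nr))

    nonroot : ∀ {x k} → depth x ≡ suc k → NonRoot x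
    nonroot d≡suc d≡0 = 0≢1+n (trans (sym d≡0) d≡suc)

    depth-parent : ∀ {x k} → depth x ≡ suc k → depth (parent x) ≡ k
    depth-parent d≡suc = suc-injective (trans (sym (proj₂ (parent-spec (nonroot d≡suc)))) d≡suc)

    depth-child : ∀ {x p} → NonRoot x → parent x ≡ p → depth x ≡ suc (depth p)
    depth-child nx refl = proj₂ (parent-spec nx)

    parent-connected : ∀ {x y} → NonRoot x → Connected x y → Connected (parent x) y
    parent-connected nx c = connected-trans (adjacent-connected (proj₁ (parent-spec nx))) c

    side-parent : ∀ {x} → NonRoot x → side x ≡ not (side (parent x))
    side-parent nx = ¬-not (λ eq → side-proper (proj₁ (parent-spec nx)) (sym eq))

    -- Induction along parents, which stay connected and descend in depth in lockstep.
    same-depth-same-side : ∀ k {x y} → depth x ≡ k → depth y ≡ k → Connected x y → side x ≡ side y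
    same-depth-same-side zero    dx dy c = cong side (roots-unique (depth-zero dx) (depth-zero dy) c)
    same-depth-same-side (suc k) {x} {y} dx dy c =
      trans (side-parent (nonroot dx))
            (trans (cong not (same-depth-same-side k (depth-parent dx) (depth-parent dy) parents-connected))
                   (sym (side-parent (nonroot dy))))
      where
      parents-connected : Connected (parent x) (parent y)
      parents-connected =
        connected-sym (parent-connected (nonroot dy) (connected-sym (parent-connected (nonroot dx) c)))

    adjacent-depths : ∀ {x y} → x ~ y → depth y ≡ suc (depth x) ⊎ depth x ≡ suc (depth y)
    adjacent-depths {x} {y} x~y with <-cmp (depth x) (depth y)
    ... | tri< x<y _ _ = inj₁ (≤-antisym (depth-adjacent x~y) x<y)
    ... | tri≈ _ x≡y _ = ⊥-elim (side-proper x~y (same-depth-same-side _ x≡y refl (adjacent-connected x~y)))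
    ... | tri> _ _ y<x = inj₂ (≤-antisym (depth-adjacent (~-sym x~y)) y<x)

    root-child : ∀ {r y} → depth r ≡ 0 → r ~ y → depth y ≡ 1 × parent y ≡ r
    root-child {r} {y} dr r~y with adjacent-depths r~y
    ... | inj₂ dr≡suc = ⊥-elim (0≢1+n (trans (sym dr) dr≡suc))
    ... | inj₁ dy≡suc = dy≡1 , roots-unique (depth-zero (depth-parent dy≡1)) (depth-zero dr)
                                  (parent-connected (nonroot dy≡1) (adjacent-connected (~-sym r~y)))
      where
      dy≡1 : depth y ≡ 1
      dy≡1 = trans dy≡suc (cong suc dr)

    root-fork : ∀ {r} → depth r ≡ 0 → ∀ i → depth (fork i r) ≡ 1 × parent (fork i r) ≡ r
    root-fork dr i = root-child dr (fork-adjacent (proj₁ (depth-zero dr)) i)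

next : Fin 3 → Fin 3
next 0F = 1F
next 1F = 2F
next 2F = 0F

mod3 : ℕ → Fin 3
mod3 zero    = 0F
mod3 (suc k) = next (mod3 k)

next-≢ : ∀ a → next a ≢ a
next-≢ 0F ()
next-≢ 1F ()
next-≢ 2F ()

next²-≢ : ∀ a → next (next a) ≢ a
next²-≢ 0F ()
next²-≢ 1F ()
next²-≢ 2F ()

next-asym : ∀ a b → a ≢ next b ⊎ b ≢ next a
next-asym a b with a ≟ next b
... | no a≢ = inj₁ a≢
... | yes refl = inj₂ λ eq → next²-≢ b (sym eq)

-- level (depth x mod 3) (matching side of x) colours the edge from x to its parent;
-- forked i (side of x) (side of the root) colours the edge from a root to its fork child i.
data Colour : Set where
  level  : Fin 3 → Bool → Colour
  forked : Bool → Bool → Bool → Colour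

bit : Colour → Bool
bit (level _ b)    = b
bit (forked _ b _) = b

encode : Colour → Fin 16
encode (level 0F false)          = # 0
encode (level 0F true)           = # 1
encode (level 1F false)          = # 2
encode (level 1F true)           = # 3
encode (level 2F false)          = # 4
encode (level 2F true)           = # 5
encode (forked false false false) = # 6
encode (forked false false true)  = # 7
encode (forked false true false)  = # 8
encode (forked false true true)   = # 9
encode (forked true false false)  = # 10
encode (forked true false true)   = # 11
encode (forked true true false)   = # 12
encode (forked true true true)    = # 13

decode : ℕ → Colour
decode 0  = level 0F false
decode 1  = level 0F true
decode 2  = level 1F false
decode 3  = level 1F true
decode 4  = level 2F false
decode 5  = level 2F true
decode 6  = forked false false false
decode 7  = forked false false true
decode 8  = forked false true false
decode 9  = forked false true true
decode 10 = forked true false false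
decode 11 = forked true false true
decode 12 = forked true true false
decode _  = forked true true true

decode-encode : ∀ c → decode (toℕ (encode c)) ≡ c
decode-encode (level 0F false)           = refl
decode-encode (level 0F true)            = refl
decode-encode (level 1F false)           = refl
decode-encode (level 1F true)            = refl
decode-encode (level 2F false)           = refl
decode-encode (level 2F true)            = refl
decode-encode (forked false false false) = refl
decode-encode (forked false false true)  = refl
decode-encode (forked false true false)  = refl
decode-encode (forked false true true)   = refl
decode-encode (forked true false false)  = refl
decode-encode (forked true false true)   = refl
decode-encode (forked true true false)   = refl
decode-encode (forked true true true)    = refl

encode-injective : ∀ {a b} → encode a ≡ encode b → a ≡ b
encode-injective {a} {b} eq =
  trans (sym (decode-encode a)) (trans (cong (decode ∘ toℕ) eq) (decode-encode b))

sorted-pair-unique : ∀ {m} {a b c d : Fin m} → a Fin.< b → c Fin.< d →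
                     c ≡ a ⊎ c ≡ b → d ≡ a ⊎ d ≡ b → (a , b) ≡ (c , d)
sorted-pair-unique a<b c<d (inj₁ refl) (inj₁ refl) = ⊥-elim (<-irrefl refl c<d)
sorted-pair-unique a<b c<d (inj₁ refl) (inj₂ refl) = refl
sorted-pair-unique a<b c<d (inj₂ refl) (inj₁ refl) = ⊥-elim (<-asym a<b c<d)
sorted-pair-unique a<b c<d (inj₂ refl) (inj₂ refl) = ⊥-elim (<-irrefl refl c<d)

module Edges (G : Graph) where

  V : Set
  V = Fin (n G)

  ends-injective : ∀ {e f : Edge G} → ends {G} e ≡ ends {G} f → e ≡ f
  ends-injective {_ , p , t} {_ , p′ , t′} refl =
    cong₂ (λ p t → (_ , p , t)) (<-irrelevant p p′) (T-irrelevant t t′)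

  data Joins (e : Edge G) (x y : V) : Set where
    forwards  : ends {G} e ≡ (x , y) → Joins e x y
    backwards : ends {G} e ≡ (y , x) → Joins e x y

  joins-sym : ∀ {e x y} → Joins e x y → Joins e y x
  joins-sym (forwards eq)  = backwards eq
  joins-sym (backwards eq) = forwards eq

  joins-incident : ∀ {e x y} → Joins e x y → Incident {G} x e
  joins-incident (forwards refl)  = inj₁ refl
  joins-incident (backwards refl) = inj₂ refl

  incident-joins : ∀ {e x y z} → Joins e x y → Incident {G} z e → z ≡ x ⊎ z ≡ y
  incident-joins (forwards refl)  (inj₁ refl) = inj₁ refl
  incident-joins (forwards refl)  (inj₂ refl) = inj₂ refl
  incident-joins (backwards refl) (inj₁ refl) = inj₂ refl
  incident-joins (backwards refl) (inj₂ refl) = inj₁ refl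

  incident-distinct-joins : ∀ {e x y} → Incident {G} x e → Incident {G} y e → x ≢ y → Joins e x y
  incident-distinct-joins (inj₁ refl) (inj₁ refl) x≢y = ⊥-elim (x≢y refl)
  incident-distinct-joins (inj₁ refl) (inj₂ refl) x≢y = forwards refl
  incident-distinct-joins (inj₂ refl) (inj₁ refl) x≢y = backwards refl
  incident-distinct-joins (inj₂ refl) (inj₂ refl) x≢y = ⊥-elim (x≢y refl)

  joins-resp : ∀ {e f x y} → SameEdge {G} e f → Joins e x y → Joins f x y
  joins-resp same (forwards eq)  = forwards (trans (sym same) eq)
  joins-resp same (backwards eq) = backwards (trans (sym same) eq)

  joins-unique : ∀ {e f x y} → Joins e x y → Joins f x y → e ≡ f
  joins-unique (forwards eq)  (forwards eq′)  = ends-injective (trans eq (sym eq′))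
  joins-unique (backwards eq) (backwards eq′) = ends-injective (trans eq (sym eq′))
  joins-unique {_ , x<y , _} {_ , y<x , _} (forwards refl) (backwards refl) = ⊥-elim (<-asym x<y y<x)
  joins-unique {_ , y<x , _} {_ , x<y , _} (backwards refl) (forwards refl) = ⊥-elim (<-asym x<y y<x)

  joins-other : ∀ {e x y z} → Joins e x y → Joins e x z → y ≡ z
  joins-other (forwards refl)  (forwards refl)  = refl
  joins-other (forwards refl)  (backwards refl) = refl
  joins-other (backwards refl) (forwards refl)  = refl
  joins-other (backwards refl) (backwards refl) = refl

  edge-with? : (P : Edge G → Set) → (∀ e → Dec (P e)) →
               ∀ x y → Dec (∃[ e ] (P e × ends {G} e ≡ (x , y)))
  edge-with? P P? x y with x <? y | T? (adj G x y)
  ... | no x≮y | _      = no λ { ((_ , x<y , _) , _ , refl) → x≮y x<y }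
  ... | yes _  | no ¬xy = no λ { ((_ , _ , xy) , _ , refl) → ¬xy xy }
  ... | yes x<y | yes xy =
        map′ (λ p → e , p , refl) (λ { (f , pf , eq) → subst P (ends-injective eq) pf }) (P? e)
    where
    e : Edge G
    e = (x , y) , x<y , xy

  joining? : (P : Edge G → Set) → (∀ e → Dec (P e)) → ∀ x y → Dec (∃[ e ] (P e × Joins e x y))
  joining? P P? x y = map′ join split (edge-with? P P? x y ⊎-dec edge-with? P P? y x)
    where
    join : (∃[ e ] (P e × ends {G} e ≡ (x , y))) ⊎ (∃[ e ] (P e × ends {G} e ≡ (y , x))) →
           ∃[ e ] (P e × Joins e x y)
    join (inj₁ (e , p , eq)) = e , p , forwards eq
    join (inj₂ (e , p , eq)) = e , p , backwards eq
    split : ∃[ e ] (P e × Joins e x y) →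
            (∃[ e ] (P e × ends {G} e ≡ (x , y))) ⊎ (∃[ e ] (P e × ends {G} e ≡ (y , x)))
    split (e , p , forwards eq)  = inj₁ (e , p , eq)
    split (e , p , backwards eq) = inj₂ (e , p , eq)

module Colouring (G : Graph) (inH : Edge G → Bool) (bip : Bipartite G inH)
                 (ntc : NoTrivialComponents G inH) (mat : IsMatching G (λ e → not (inH e))) where

  open Edges G

  _~_ : V → V → Set
  x ~ y = ∃[ e ] (inH e ≡ true × Joins e x y)

  _~?_ : ∀ x y → Dec (x ~ y)
  _~?_ = joining? (λ e → inH e ≡ true) (λ e → inH e ≟ᵇ true)

  ~-sym : ∀ {x y} → x ~ y → y ~ x
  ~-sym (e , h , j) = e , h , joins-sym j

  joins-adjacent : ∀ {e x y} → Joins e x y → x ~ y → inH e ≡ true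
  joins-adjacent j (f , h , j′) = subst (λ e → inH e ≡ true) (joins-unique j′ j) h

  open Walks _~_ _~?_ ~-sym

  reach-connected : ∀ {x y} → Reach G inH x y → Connected x y
  reach-connected here                       = connected-refl
  reach-connected (step e h ix iy x≢y reach) =
    connected-trans (adjacent-connected (e , h , incident-distinct-joins ix iy x≢y)) (reach-connected reach)

  -- If neither end of the first edge branches, the component of x consists of that edge alone,
  -- which leaves no room for the second edge.
  opaque
    branching-nearby : ∀ x → ∃[ r ] (Branching r × Connected r x)
    branching-nearby x with ntc x
    ... | e₁@((a , b) , a<b , _) , e₂@((c , d) , c<d , _) , h₁ , h₂ , e₁≢e₂ , x→a , x→c
      with branching? a | branching? b
    ... | yes br | _      = a , br , connected-sym (reach-connected x→a)
    ... | no _   | yes br = b , br , connected-trans (adjacent-connected (e₁ , h₁ , backwards refl))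
                                                      (connected-sym (reach-connected x→a))
    ... | no ¬br-a | no ¬br-b = ⊥-elim (e₁≢e₂ (sorted-pair-unique a<b c<d (within a→c) (within a→d)))
      where
      a→c : Connected a c
      a→c = connected-trans (connected-sym (reach-connected x→a)) (reach-connected x→c)
      a→d : Connected a d
      a→d = connected-trans a→c (adjacent-connected (e₂ , h₂ , forwards refl))
      within : ∀ {z} → Connected a z → z ≡ a ⊎ z ≡ b
      within = isolated-edge (e₁ , h₁ , forwards refl) ¬br-a ¬br-b _

    side-proper : ∀ {x y} → x ~ y → proj₁ bip x ≢ proj₁ bip y
    side-proper (e , h , forwards refl)  = proj₂ bip e h
    side-proper (e , h , backwards refl) = λ eq → proj₂ bip e h (sym eq)

  open Forest branching-nearby (proj₁ bip) side-proper

  -- Whether u is the larger end of a matching edge: a proper 2-colouring of the matching.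
  opaque
    matchSide : V → Bool
    matchSide u = does (any? λ v → edge-with? (λ e → inH e ≡ false) (λ e → inH e ≟ᵇ false) v u)

    matchSide-ends : ∀ {e} → inH e ≡ false →
                     matchSide (proj₁ (ends {G} e)) ≡ false × matchSide (proj₂ (ends {G} e)) ≡ true
    matchSide-ends {e@((a , b) , a<b , _)} h =
      dec-false (any? _) not-upper , dec-true (any? _) (a , e , h , refl)
      where
      not-upper : ¬ (∃[ v ] ∃[ f ] (inH f ≡ false × ends {G} f ≡ (v , a)))
      not-upper (v , f , h′ , refl) with mat e f (cong not h) (cong not h′) (a , inj₁ refl , inj₂ refl)
      ... | refl = <-irrefl refl a<b

  matchSide-differs : ∀ {e u v} → inH e ≡ false → Joins e u v → matchSide u ≢ matchSide v
  matchSide-differs h (forwards refl) eq with matchSide-ends h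
  ... | lower , upper = contradiction (trans (sym lower) (trans eq upper)) λ ()
  matchSide-differs h (backwards refl) eq with matchSide-ends h
  ... | lower , upper = contradiction (trans (sym lower) (trans (sym eq) upper)) λ ()

  ForkChild : Bool → V → Set
  ForkChild i w = depth w ≡ 1 × w ≡ fork i (parent w)

  opaque
    forkChild? : ∀ i w → Dec (ForkChild i w)
    forkChild? i w = depth w ℕ.≟ 1 ×-dec w ≟ fork i (parent w)

  fork-child-unique : ∀ {w} → ForkChild false w → ¬ ForkChild true w
  fork-child-unique (d≡1 , w≡fork₀) (_ , w≡fork₁) =
    fork-distinct (proj₁ (depth-zero (depth-parent d≡1))) (trans (sym w≡fork₀) w≡fork₁)

  some-fork-avoids : ∀ v → ∃[ i ] ¬ ForkChild i v
  some-fork-avoids v with forkChild? false v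
  ... | yes fc = true , fork-child-unique fc
  ... | no ¬fc = false , ¬fc

  opaque
    colour : V → Colour
    colour w with forkChild? false w | forkChild? true w
    ... | yes _ | _     = forked false (matchSide w) (matchSide (parent w))
    ... | no _  | yes _ = forked true  (matchSide w) (matchSide (parent w))
    ... | no _  | no _  = level (mod3 (depth w)) (matchSide w)

    bit-colour : ∀ w → bit (colour w) ≡ matchSide w
    bit-colour w with forkChild? false w | forkChild? true w
    ... | yes _ | _     = refl
    ... | no _  | yes _ = refl
    ... | no _  | no _  = refl

    colour-level : ∀ {w} → depth w ≢ 1 → colour w ≡ level (mod3 (depth w)) (matchSide w)
    colour-level {w} d≢1 with forkChild? false w | forkChild? true w
    ... | yes (d≡1 , _) | _             = ⊥-elim (d≢1 d≡1)
    ... | no _          | yes (d≡1 , _) = ⊥-elim (d≢1 d≡1)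
    ... | no _          | no _          = refl

    colour-fork-child : ∀ {i w} → ForkChild i w → colour w ≡ forked i (matchSide w) (matchSide (parent w))
    colour-fork-child {i} {w} fc with forkChild? false w | forkChild? true w
    colour-fork-child {false} fc | yes _   | _       = refl
    colour-fork-child {true}  fc | yes fc₀ | _       = ⊥-elim (fork-child-unique fc₀ fc)
    colour-fork-child {false} fc | no ¬fc  | _       = ⊥-elim (¬fc fc)
    colour-fork-child {true}  fc | no _    | yes _   = refl
    colour-fork-child {true}  fc | no _    | no ¬fc  = ⊥-elim (¬fc fc)

    forked-colour : ∀ {i b c w} → colour w ≡ forked i b c → ForkChild i w × c ≡ matchSide (parent w)
    forked-colour {w = w} eq with forkChild? false w | forkChild? true w | eq
    ... | yes fc | _     | refl = fc , refl
    ... | no _   | yes fc | refl = fc , refl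
    ... | no _   | no _   | ()

    level-colour : ∀ {k b w} → colour w ≡ level k b → k ≡ mod3 (depth w)
    level-colour {w = w} eq with forkChild? false w | forkChild? true w | eq
    ... | yes _ | _     | ()
    ... | no _  | yes _ | ()
    ... | no _  | no _  | refl = refl

  level-clash : ∀ {w p u} → depth w ≡ suc (depth p) → NonRoot p → colour w ≡ colour u →
                next (mod3 (depth p)) ≡ mod3 (depth u)
  level-clash {w} dw np same = trans (cong mod3 (sym dw)) (level-colour (trans (sym same) (colour-level d≢1)))
    where
    d≢1 : depth w ≢ 1
    d≢1 d≡1 = np (suc-injective (trans (sym dw) d≡1))

  ChildOf : V → V → Set
  ChildOf x p = NonRoot x × parent x ≡ p

  opaque
    childOf? : ∀ x p → Dec (ChildOf x p)
    childOf? x p = ¬? (depth x ℕ.≟ 0) ×-dec parent x ≟ p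

  child-not-parent : ∀ {x p} → ChildOf x p → ¬ ChildOf p x
  child-not-parent {x} (nx , px) (np , pp) =
    m≢1+n+m (depth x) (trans (depth-child nx px) (cong suc (depth-child np pp)))

  opaque
    treeColour : V → V → Maybe (Fin 16)
    treeColour a b with childOf? b a | childOf? a b
    ... | yes _ | _     = just (encode (colour b))
    ... | no _  | yes _ = just (encode (colour a))
    ... | no _  | no _  = nothing

    colouring : PartialColouring G 16
    colouring e = if inH e then treeColour (proj₁ (ends {G} e)) (proj₂ (ends {G} e)) else nothing

    coloured-edge : ∀ {f α} → colouring f ≡ just α →
                    ∃[ w ] (NonRoot w × Joins f w (parent w) × encode (colour w) ≡ α)
    coloured-edge {f@((a , b) , _)} eq with inH f
    ... | false = contradiction eq λ ()
    ... | true with childOf? b a | childOf? a b | eq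
    ...   | yes (nb , refl) | _               | refl = b , nb , backwards refl , refl
    ...   | no _            | yes (na , refl) | refl = a , na , forwards refl , refl
    ...   | no _            | no _            | ()

    colouring-H : ∀ {e} → inH e ≡ true →
                  colouring e ≡ treeColour (proj₁ (ends {G} e)) (proj₂ (ends {G} e))
    colouring-H {e} h =
      cong (λ b → if b then treeColour (proj₁ (ends {G} e)) (proj₂ (ends {G} e)) else nothing) h

    treeColour-child : ∀ {a b} → ChildOf b a → treeColour a b ≡ just (encode (colour b))
    treeColour-child {a} {b} c with childOf? b a
    ... | yes _ = refl
    ... | no ¬c = ⊥-elim (¬c c)

    treeColour-parent : ∀ {a b} → ChildOf a b → treeColour a b ≡ just (encode (colour a))
    treeColour-parent {a} {b} c with childOf? b a | childOf? a b
    ... | yes c′ | _     = ⊥-elim (child-not-parent c c′)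
    ... | no _   | yes _ = refl
    ... | no _   | no ¬c = ⊥-elim (¬c c)

  tree-edge-coloured : ∀ {e x} → NonRoot x → inH e ≡ true → Joins e x (parent x) →
                       colouring e ≡ just (encode (colour x))
  tree-edge-coloured nx h (forwards refl)  = trans (colouring-H h) (treeColour-parent (nx , refl))
  tree-edge-coloured nx h (backwards refl) = trans (colouring-H h) (treeColour-child (nx , refl))

  data Meets (w u v : V) : Set where
    child-u  : w ≡ u → Meets w u v
    child-v  : w ≡ v → Meets w u v
    parent-u : parent w ≡ u → Meets w u v
    parent-v : parent w ≡ v → Meets w u v

  meets : ∀ {w u v z} → z ≡ u ⊎ z ≡ v → z ≡ w ⊎ z ≡ parent w → Meets w u v
  meets (inj₁ refl) (inj₁ refl) = child-u refl
  meets (inj₂ refl) (inj₁ refl) = child-v refl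
  meets (inj₁ refl) (inj₂ refl) = parent-u refl
  meets (inj₂ refl) (inj₂ refl) = parent-v refl

  satisfied-by-tree-edge : ∀ {e u v x} → Joins e u v → NonRoot x → x ≡ u ⊎ parent x ≡ u →
    ¬ Joins e x (parent x) →
    (∀ {w} → NonRoot w → w ≢ x → colour w ≡ colour x → ¬ Meets w u v) →
    Satisfied {G} {16} colouring e
  satisfied-by-tree-edge {e} {u} {v} {x} j nx x-at-u ¬tree no-rival with parent-spec nx
  ... | (t , h , jt) , _ =
    encode (colour x) , t , (u , joins-incident j , u∈t x-at-u) , t≢e ,
    tree-edge-coloured nx h (joins-sym jt) , unique
    where
    u∈t : x ≡ u ⊎ parent x ≡ u → Incident {G} u t
    u∈t (inj₁ refl) = joins-incident (joins-sym jt)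
    u∈t (inj₂ refl) = joins-incident jt
    t≢e : ¬ SameEdge {G} t e
    t≢e same = ¬tree (joins-resp same (joins-sym jt))
    unique : ∀ f → InClosedNbh {G} e f → ¬ SameEdge {G} f t → ¬ colouring f ≡ just (encode (colour x))
    unique f (z , z∈e , z∈f) f≢t cf with coloured-edge cf
    ... | w , nw , jw , same =
      no-rival nw w≢x (encode-injective same) (meets (incident-joins j z∈e) (incident-joins jw z∈f))
      where
      w≢x : w ≢ x
      w≢x refl = f≢t (cong (ends {G}) (joins-unique jw (joins-sym jt)))

  satisfied-by-parent-edge : ∀ {e u v} → Joins e u v → NonRoot u → NonRoot v → ¬ Joins e u (parent u) →
    colour v ≢ colour u → mod3 (depth u) ≢ mod3 (suc (depth v)) → Satisfied {G} {16} colouring e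
  satisfied-by-parent-edge {u = u} {v} j nu nv ¬tree v≢u sep =
    satisfied-by-tree-edge j nu (inj₁ refl) ¬tree no-rival
    where
    no-rival : ∀ {w} → NonRoot w → w ≢ u → colour w ≡ colour u → ¬ Meets w u v
    no-rival nw w≢u same (child-u w≡u)  = w≢u w≡u
    no-rival nw w≢u same (child-v refl) = v≢u same
    no-rival nw w≢u same (parent-u pu)  = next-≢ _ (level-clash (depth-child nw pu) nu same)
    no-rival nw w≢u same (parent-v pv)  = sep (sym (level-clash (depth-child nw pv) nv same))

  satisfied-by-fork-edge : ∀ {e u v i} → Joins e u v → depth u ≡ 0 → ¬ ForkChild i v →
    (depth v ≡ 0 → matchSide v ≢ matchSide u) → Satisfied {G} {16} colouring e
  satisfied-by-fork-edge {e} {u} {v} {i} j du ¬fork-v sides with root-fork du i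
  ... | dx , px = satisfied-by-tree-edge j (nonroot dx) (inj₂ px) ¬tree no-rival
    where
    x-fork : ForkChild i (fork i u)
    x-fork = dx , cong (fork i) (sym px)
    ¬tree : ¬ Joins e (fork i u) (parent (fork i u))
    ¬tree jx with joins-other j (joins-sym (subst (Joins e (fork i u)) px jx))
    ... | refl = ¬fork-v x-fork
    x-colour : colour (fork i u) ≡ forked i (matchSide (fork i u)) (matchSide u)
    x-colour = trans (colour-fork-child x-fork) (cong (forked i (matchSide (fork i u)) ∘ matchSide) px)
    no-rival : ∀ {w} → NonRoot w → w ≢ fork i u → colour w ≡ colour (fork i u) → ¬ Meets w u v
    no-rival {w} nw w≢x same m with forked-colour (trans same x-colour)
    ... | (dw , w≡fork) , sides≡ with m
    ...   | child-u wu  = 0≢1+n (trans (sym du) (trans (cong depth (sym wu)) dw))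
    ...   | child-v wv  = ¬fork-v (subst (ForkChild i) wv (dw , w≡fork))
    ...   | parent-u pu = w≢x (trans w≡fork (cong (fork i) pu))
    ...   | parent-v pv = sides (trans (cong depth (sym pv)) (depth-parent dw))
                                (trans (cong matchSide (sym pv)) (sym sides≡))

  satisfied-in-H : ∀ {e u v} → inH e ≡ true → Joins e u v → depth v ≡ suc (depth u) →
                       Satisfied {G} {16} colouring e
  satisfied-in-H {e} {u} {v} h j dv with depth u ℕ.≟ 0
  ... | yes du = satisfied-by-fork-edge j du (proj₂ (some-fork-avoids v))
                   λ dv≡0 → ⊥-elim (0≢1+n (trans (sym dv≡0) dv))
  ... | no nu  = satisfied-by-parent-edge j nu (nonroot dv) ¬tree v≢u sep
    where
    ¬tree : ¬ Joins e u (parent u)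
    ¬tree ju = m≢1+n+m (depth u) (trans (depth-child nu (sym (joins-other j ju))) (cong suc dv))
    v≢u : colour v ≢ colour u
    v≢u same = next-≢ _ (level-clash dv nu same)
    sep : mod3 (depth u) ≢ mod3 (suc (depth v))
    sep eq = next²-≢ _ (sym (trans eq (cong (mod3 ∘ suc) dv)))

  matching-edge-not-tree-edge : ∀ {e u} → inH e ≡ false → NonRoot u → ¬ Joins e u (parent u)
  matching-edge-not-tree-edge h nu ju =
    contradiction (trans (sym h) (joins-adjacent (joins-sym ju) (proj₁ (parent-spec nu)))) λ ()

  matching-colours-differ : ∀ {e u v} → inH e ≡ false → Joins e u v → colour v ≢ colour u
  matching-colours-differ {u = u} {v} h j same =
    matchSide-differs h j (trans (sym (bit-colour u)) (trans (cong bit (sym same)) (bit-colour v)))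

  satisfied-at-matched-root : ∀ {e u v} → inH e ≡ false → Joins e u v → depth u ≡ 0 →
                              Satisfied {G} {16} colouring e
  satisfied-at-matched-root {v = v} h j du =
    satisfied-by-fork-edge j du (proj₂ (some-fork-avoids v)) λ _ → matchSide-differs h (joins-sym j)

  satisfied-in-matching : ∀ {e u v} → inH e ≡ false → Joins e u v → Satisfied {G} {16} colouring e
  satisfied-in-matching {u = u} {v} h j with depth u ℕ.≟ 0 | depth v ℕ.≟ 0
  ... | yes du | _      = satisfied-at-matched-root h j du
  ... | no _   | yes dv = satisfied-at-matched-root h (joins-sym j) dv
  ... | no nu  | no nv with next-asym (mod3 (depth u)) (mod3 (depth v))
  ...   | inj₁ sep = satisfied-by-parent-edge j nu nv (matching-edge-not-tree-edge h nu)
                       (matching-colours-differ h j) sep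
  ...   | inj₂ sep = satisfied-by-parent-edge (joins-sym j) nv nu (matching-edge-not-tree-edge h nv)
                       (matching-colours-differ h (joins-sym j)) sep

  satisfied : ∀ e → Satisfied {G} {16} colouring e
  satisfied e with inH e in h
  ... | false = satisfied-in-matching h (forwards refl)
  ... | true with adjacent-depths (e , h , forwards refl)
  ...   | inj₁ d = satisfied-in-H h (forwards refl) d
  ...   | inj₂ d = satisfied-in-H h (backwards refl) d

mainTheorem6 : (G : Graph) (inH : Edge G → Bool) →
    Bipartite G inH → NoTrivialComponents G inH →
    IsMatching G (λ e → not (inH e)) →
    ∃[ c ] ((e : Edge G) → Satisfied {G} {16} c e)
mainTheorem6 G inH bip ntc mat = colouring , satisfied
  where open Colouring G inH bip ntc mat
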